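{- Let $G$ be a finite graph and let $C\in\mathfrak{M}(G)$ with $|C|\geq 2$. Then exactly one of the following holds: (i) $C\in\mathcal{P}(G)$; (ii) $C$ is a maximal element under inclusion among the modules of $G$ that are cliques in $G$; (iii) $C$ is a maximal element under inclusion among the modules of $G$ that are stable sets in $G$.
   Context: Graphs are finite, simple, undirected. A module of $G$ is a set $M\subseteq V(G)$ such that each vertex outside $M$ is adjacent to all or none of $M$; trivial modules are $\emptyset$, $V(G)$, singletons; $G$ is prime if $|V(G)|\ge 4$ and all modules are trivial. $\mathcal{M}_{\min}(G)$ is the family of minimal elements under inclusion among the modules of $G$ of cardinality at least $2$. $\mathcal{P}(G)$ is the family of modules $M$ of $G$ such that $G[M]$ is prime. The relation $\approx_G$ on $V(G)$: $u\approx_G v$ iff $u=v$ or there is $M\in\mathcal{M}_{\min}(G)$ with $u,v\in M$; it is an equivalence relation, and $\mathfrak{M}(G)$ denotes its set of equivalence classes. -}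

module Defs where

open import Data.Nat using (ℕ; _≤_)
open import Data.Fin using (Fin)
open import Data.Fin.Subset using (Subset; _∈_; _∉_; _⊆_; ∣_∣; ⊥; ⁅_⁆)
open import Data.Bool using (Bool; true; false)
open import Data.Product using (Σ; _×_; ∃)
open import Data.Sum using (_⊎_)
open import Relation.Binary.PropositionalEquality using (_≡_; _≢_)
open import Relation.Nullary using (¬_)
open import Function.Bundles using (_⇔_)

record Graph (n : ℕ) : Set where
  field
    adj    : Fin n → Fin n → Bool
    sym    : ∀ u v → adj u v ≡ adj v u
    irrefl : ∀ u → adj u u ≡ false
open Graph public

module _ {n : ℕ} (G : Graph n) where

  -- M is a module of the induced subgraph G[W] (where M ⊆ W is assumed
  -- separately): every vertex of W outside M is adjacent to all or none of M.
  IsModuleIn : Subset n → Subset n → Set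
  IsModuleIn W M =
    ∀ x → x ∈ W → x ∉ M →
      (∀ u → u ∈ M → adj G x u ≡ true) ⊎ (∀ u → u ∈ M → adj G x u ≡ false)

  IsModule : Subset n → Set
  IsModule M = ∀ x → x ∉ M →
      (∀ u → u ∈ M → adj G x u ≡ true) ⊎ (∀ u → u ∈ M → adj G x u ≡ false)

  IsPrimeInduced : Subset n → Set
  IsPrimeInduced M =
    (4 ≤ ∣ M ∣) ×
    (∀ X → X ⊆ M → IsModuleIn M X →
       (X ≡ ⊥) ⊎ (X ≡ M) ⊎ ∃ (λ v → X ≡ ⁅ v ⁆))

  InP : Subset n → Set
  InP M = IsModule M × IsPrimeInduced M

  InMmin : Subset n → Set
  InMmin M = IsModule M × (2 ≤ ∣ M ∣) ×
    (∀ M′ → IsModule M′ → 2 ≤ ∣ M′ ∣ → M′ ⊆ M → M′ ≡ M)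

  _≈G_ : Fin n → Fin n → Set
  u ≈G v = (u ≡ v) ⊎ Σ (Subset n) (λ M → InMmin M × u ∈ M × v ∈ M)

  IsClass : Subset n → Set
  IsClass C = Σ (Fin n) (λ u → ∀ v → (v ∈ C ⇔ u ≈G v))

  IsClique : Subset n → Set
  IsClique C = ∀ u v → u ∈ C → v ∈ C → u ≢ v → adj G u v ≡ true

  IsStable : Subset n → Set
  IsStable C = ∀ u v → u ∈ C → v ∈ C → adj G u v ≡ false

  MaxCliqueModule : Subset n → Set
  MaxCliqueModule C = IsModule C × IsClique C ×
    (∀ M → IsModule M → IsClique M → C ⊆ M → M ≡ C)

  MaxStableModule : Subset n → Set
  MaxStableModule C = IsModule C × IsStable C ×
    (∀ M → IsModule M → IsStable M → C ⊆ M → M ≡ C)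

ExactlyOne : Set → Set → Set → Set
ExactlyOne A B C = (A ⊎ B ⊎ C) × ¬ (A × B) × ¬ (A × C) × ¬ (B × C)

-- Take u in the class and a minimal module M through u. If |M| ≥ 3, M meets no other minimal
-- module (M would be covered by its proper submodules M ∩ M′ and M ∖ M′, each of at most one
-- vertex), so the class of u is M; and M is prime, since every three-vertex graph has a two-vertex
-- module. If |M| = 2, no minimal module through u has three vertices, so {u, w} is a module for
-- every w ≈ u; this makes the class a module on which adjacency is constant, and it is maximal
-- because two vertices of a clique or stable module always form a minimal module. A prime graph is
-- neither complete nor edgeless, so the alternatives exclude each other.
module Submission where

open import Defs
open import Data.Bool using (Bool; true; false)
import Data.Bool.Properties as Bool
open import Data.Fin using (Fin)
open import Data.Fin.Properties using (any?; _≟_)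
open import Data.Fin.Subset
open import Data.Fin.Subset.Properties
open import Data.List using (List; []; _∷_; length)
import Data.List.Relation.Unary.All as All
open import Data.List.Relation.Unary.All using (All; []; _∷_)
open import Data.List.Relation.Unary.Unique.Propositional using (Unique; []; _∷_)
open import Data.Nat using (ℕ; _≤_; _<_; s≤s; s≤s⁻¹; z≤n; _+_; _≤?_)
open import Data.Nat.Properties
  using (≤-trans; ≤-antisym; ≤-reflexive; +-suc; +-monoʳ-≤; +-mono-≤; n≤1+n; ≤⇒≯; <⇒≱; ≰⇒>)
open import Data.Product using (∃; _×_; _,_; proj₁; proj₂)
open import Data.Sum using (_⊎_; inj₁; inj₂)
open import Data.Vec using ([]; _∷_)
import Data.Sum as Sum
open import Function using (_∘_)
open import Function.Bundles using (_⇔_; Equivalence)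
open import Relation.Binary.PropositionalEquality as ≡
  using (_≡_; _≢_; refl; trans; subst; cong; ≢-sym)
open import Relation.Nullary using (¬_; yes; no; contradiction)
open import Relation.Nullary.Decidable using (_×-dec_; ¬?; decidable-stable)

private
  variable
    n : ℕ
    k k′ : Bool
    u v w x y z : Fin n
    p q M M′ S X : Subset n

∣p∪q∣≤∣p∣+∣q∣ : (p q : Subset n) → ∣ p ∪ q ∣ ≤ ∣ p ∣ + ∣ q ∣
∣p∪q∣≤∣p∣+∣q∣ []            []            = z≤n
∣p∪q∣≤∣p∣+∣q∣ (inside ∷ p)  (inside ∷ q)  =
  s≤s (≤-trans (∣p∪q∣≤∣p∣+∣q∣ p q) (+-monoʳ-≤ ∣ p ∣ (n≤1+n _)))
∣p∪q∣≤∣p∣+∣q∣ (inside ∷ p)  (outside ∷ q) = s≤s (∣p∪q∣≤∣p∣+∣q∣ p q)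
∣p∪q∣≤∣p∣+∣q∣ (outside ∷ p) (inside ∷ q)  =
  ≤-trans (s≤s (∣p∪q∣≤∣p∣+∣q∣ p q)) (≤-reflexive (≡.sym (+-suc ∣ p ∣ ∣ q ∣)))
∣p∪q∣≤∣p∣+∣q∣ (outside ∷ p) (outside ∷ q) = ∣p∪q∣≤∣p∣+∣q∣ p q

unique⇒length≤∣p∣ : {xs : List (Fin n)} → Unique xs → All (_∈ p) xs → length xs ≤ ∣ p ∣
unique⇒length≤∣p∣ []             []           = z≤n
unique⇒length≤∣p∣ (x≢xs ∷ !xs) (x∈p ∷ xs⊆p) =
  ≤-trans (s≤s (unique⇒length≤∣p∣ !xs (All.zipWith ∈p-x (x≢xs , xs⊆p)))) (x∈p⇒∣p-x∣<∣p∣ x∈p)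
  where
  ∈p-x : x ≢ y × y ∈ p → y ∈ p - x
  ∈p-x (x≢y , y∈p) = x∈p∧x≢y⇒x∈p-y y∈p (≢-sym x≢y)

⊆⊎∃∉ : (p q : Subset n) → p ⊆ q ⊎ ∃ λ x → x ∈ p × x ∉ q
⊆⊎∃∉ p q with any? (λ x → x ∈? p ×-dec ¬? (x ∈? q))
... | yes p∖q-nonempty = inj₂ p∖q-nonempty
... | no  p∖q-empty    =
  inj₁ λ {x} x∈p → decidable-stable (x ∈? q) (λ x∉q → p∖q-empty (x , x∈p , x∉q))

∣q∣<∣p∣⇒∃∈p∖q : ∣ q ∣ < ∣ p ∣ → ∃ λ x → x ∈ p × x ∉ q
∣q∣<∣p∣⇒∃∈p∖q {q = q} {p = p} ∣q∣<∣p∣ with ⊆⊎∃∉ p q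
... | inj₁ p⊆q     = contradiction (p⊆q⇒∣p∣≤∣q∣ p⊆q) (<⇒≱ ∣q∣<∣p∣)
... | inj₂ witness = witness

0<∣p∣⇒nonempty : ∀ {n} {p : Subset n} → 0 < ∣ p ∣ → Nonempty p
0<∣p∣⇒nonempty {n} {p} 0<∣p∣
  with x , x∈p , _ ← ∣q∣<∣p∣⇒∃∈p∖q {q = ⊥} (subst (_< ∣ p ∣) (≡.sym (∣⊥∣≡0 n)) 0<∣p∣)
  = x , x∈p

1<∣p∣⇒∃≢ : 1 < ∣ p ∣ → (x : Fin n) → ∃ λ y → y ∈ p × y ≢ x
1<∣p∣⇒∃≢ {p = p} 1<∣p∣ x
  with y , y∈p , y∉⁅x⁆ ← ∣q∣<∣p∣⇒∃∈p∖q (subst (_< ∣ p ∣) (≡.sym (∣⁅x⁆∣≡1 x)) 1<∣p∣)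
  = y , y∈p , x∉⁅y⁆⇒x≢y y∉⁅x⁆

p⊆q∧∣q∣≤∣p∣⇒p≡q : p ⊆ q → ∣ q ∣ ≤ ∣ p ∣ → p ≡ q
p⊆q∧∣q∣≤∣p∣⇒p≡q {p = p} {q = q} p⊆q ∣q∣≤∣p∣ with ⊆⊎∃∉ q p
... | inj₁ q⊆p              = ⊆-antisym p⊆q q⊆p
... | inj₂ (x , x∈q , x∉p) = contradiction (p⊂q⇒∣p∣<∣q∣ (p⊆q , x , x∈q , x∉p)) (≤⇒≯ ∣q∣≤∣p∣)

x∈p⇒⁅x⁆⊆p : x ∈ p → ⁅ x ⁆ ⊆ p
x∈p⇒⁅x⁆⊆p {x = x} x∈p y∈⁅x⁆ rewrite x∈⁅y⁆⇒x≡y x y∈⁅x⁆ = x∈p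

∣p∣≤1⇒p≡⊥⊎⁅x⁆ : ∣ p ∣ ≤ 1 → p ≡ ⊥ ⊎ ∃ λ x → p ≡ ⁅ x ⁆
∣p∣≤1⇒p≡⊥⊎⁅x⁆ {p = p} ∣p∣≤1 with nonempty? p
... | no  p-empty       = inj₁ (Empty-unique p-empty)
... | yes (x , x∈p) =
  inj₂ (x , ≡.sym (p⊆q∧∣q∣≤∣p∣⇒p≡q (x∈p⇒⁅x⁆⊆p x∈p) (subst (∣ p ∣ ≤_) (≡.sym (∣⁅x⁆∣≡1 x)) ∣p∣≤1)))

pair : Fin n → Fin n → Subset n
pair x y = ⁅ x ⁆ ∪ ⁅ y ⁆

x∈pair : x ∈ pair x y
x∈pair {x = x} = x∈p∪q⁺ (inj₁ (x∈⁅x⁆ x))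

y∈pair : y ∈ pair x y
y∈pair {y = y} = x∈p∪q⁺ (inj₂ (x∈⁅x⁆ y))

∈pair⁻ : z ∈ pair x y → z ≡ x ⊎ z ≡ y
∈pair⁻ {x = x} {y = y} z∈ = Sum.map (x∈⁅y⁆⇒x≡y x) (x∈⁅y⁆⇒x≡y y) (x∈p∪q⁻ ⁅ x ⁆ ⁅ y ⁆ z∈)

≢⇒∉pair : z ≢ x → z ≢ y → z ∉ pair x y
≢⇒∉pair z≢x z≢y z∈ = Sum.[ z≢x , z≢y ] (∈pair⁻ z∈)

∉pair⇒≢ : z ∉ pair x y → z ≢ x × z ≢ y
∉pair⇒≢ z∉xy = (λ { refl → z∉xy x∈pair }) , (λ { refl → z∉xy y∈pair })

pair⊆p : x ∈ p → y ∈ p → pair x y ⊆ p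
pair⊆p x∈p y∈p z∈ with ∈pair⁻ z∈
... | inj₁ refl = x∈p
... | inj₂ refl = y∈p

∣pair∣≤2 : (x y : Fin n) → ∣ pair x y ∣ ≤ 2
∣pair∣≤2 x y =
  ≤-trans (∣p∪q∣≤∣p∣+∣q∣ ⁅ x ⁆ ⁅ y ⁆) (≤-reflexive (≡.cong₂ _+_ (∣⁅x⁆∣≡1 x) (∣⁅x⁆∣≡1 y)))

2≤∣pair∣ : x ≢ y → 2 ≤ ∣ pair x y ∣
2≤∣pair∣ x≢y = unique⇒length≤∣p∣ ((x≢y ∷ []) ∷ [] ∷ []) (x∈pair ∷ y∈pair ∷ [])

bool-pigeonhole : (a b c : Bool) → a ≡ b ⊎ b ≡ c ⊎ c ≡ a
bool-pigeonhole false false _     = inj₁ refl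
bool-pigeonhole true  true  _     = inj₁ refl
bool-pigeonhole false true  true  = inj₂ (inj₁ refl)
bool-pigeonhole true  false false = inj₂ (inj₁ refl)
bool-pigeonhole false true  false = inj₂ (inj₂ refl)
bool-pigeonhole true  false true  = inj₂ (inj₂ refl)

module _ (G : Graph n) where

  AllOrNone : Fin n → Subset n → Set
  AllOrNone x M = (∀ u → u ∈ M → adj G x u ≡ true) ⊎ (∀ u → u ∈ M → adj G x u ≡ false)

  Uniform : Bool → Subset n → Set
  Uniform k S = ∀ x y → x ∈ S → y ∈ S → x ≢ y → adj G x y ≡ k

  PairModulesAt : Fin n → Subset n → Set
  PairModulesAt u S = ∀ w → w ∈ S → w ≢ u → IsModule G (pair u w)

  constant⇒allOrNone : (k : Bool) → (∀ u → u ∈ M → adj G x u ≡ k) → AllOrNone x M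
  constant⇒allOrNone true  = inj₁
  constant⇒allOrNone false = inj₂

  allOrNone⇒adj≡ : AllOrNone x M → u ∈ M → v ∈ M → adj G x u ≡ adj G x v
  allOrNone⇒adj≡ (inj₁ all)  u∈M v∈M = trans (all _ u∈M) (≡.sym (all _ v∈M))
  allOrNone⇒adj≡ (inj₂ none) u∈M v∈M = trans (none _ u∈M) (≡.sym (none _ v∈M))

  adj≡⇒allOrNone : (∀ {u v} → u ∈ M → v ∈ M → adj G x u ≡ adj G x v) → AllOrNone x M
  adj≡⇒allOrNone {M = M} {x = x} alike with nonempty? M
  ... | yes (u , u∈M) = constant⇒allOrNone (adj G x u) (λ v v∈M → alike v∈M u∈M)
  ... | no  M-empty   = inj₁ (λ v v∈M → contradiction (v , v∈M) M-empty)

  allOrNone-⊆ : X ⊆ M → AllOrNone x M → AllOrNone x X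
  allOrNone-⊆ X⊆M (inj₁ all)  = inj₁ (λ u → all u ∘ X⊆M)
  allOrNone-⊆ X⊆M (inj₂ none) = inj₂ (λ u → none u ∘ X⊆M)

  isModule⇒adjʳ≡ : IsModule G M → x ∉ M → u ∈ M → v ∈ M → adj G x u ≡ adj G x v
  isModule⇒adjʳ≡ M-mod x∉M = allOrNone⇒adj≡ (M-mod _ x∉M)

  isModule⇒adjˡ≡ : IsModule G M → u ∈ M → v ∈ M → x ∉ M → adj G u x ≡ adj G v x
  isModule⇒adjˡ≡ {u = u} {v = v} {x = x} M-mod u∈M v∈M x∉M =
    trans (sym G u x) (trans (isModule⇒adjʳ≡ M-mod x∉M u∈M v∈M) (sym G x v))

  adj≡⇒isModule : (∀ {x u v} → x ∉ M → u ∈ M → v ∈ M → adj G x u ≡ adj G x v) → IsModule G M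
  adj≡⇒isModule alike x x∉M = adj≡⇒allOrNone (alike x∉M)

  pair-isModule⇒adj≡ : IsModule G (pair x y) → z ≢ x → z ≢ y → adj G z x ≡ adj G z y
  pair-isModule⇒adj≡ xy-mod z≢x z≢y = isModule⇒adjʳ≡ xy-mod (≢⇒∉pair z≢x z≢y) x∈pair y∈pair

  ∩-isModule : IsModule G M → IsModule G M′ → IsModule G (M ∩ M′)
  ∩-isModule {M = M} {M′ = M′} M-mod M′-mod x x∉M∩M′ with x ∈? M
  ... | yes x∈M = allOrNone-⊆ (p∩q⊆q M M′) (M′-mod x (λ x∈M′ → x∉M∩M′ (x∈p∩q⁺ (x∈M , x∈M′))))
  ... | no  x∉M = allOrNone-⊆ (p∩q⊆p M M′) (M-mod x x∉M)

  ∖-isModule : IsModule G M → IsModule G M′ → w ∈ M′ → w ∉ M → IsModule G (M ∩ ∁ M′)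
  ∖-isModule {M = M} {M′ = M′} {w = w} M-mod M′-mod w∈M′ w∉M = adj≡⇒isModule alike
    where
    alike : x ∉ M ∩ ∁ M′ → u ∈ M ∩ ∁ M′ → v ∈ M ∩ ∁ M′ → adj G x u ≡ adj G x v
    alike {x = x} {u = u} {v = v} x∉D u∈D v∈D with x∈p∩q⁻ M (∁ M′) u∈D | x∈p∩q⁻ M (∁ M′) v∈D
    ... | u∈M , u∈∁M′ | v∈M , v∈∁M′ with x ∈? M′
    ... | yes x∈M′ = begin
      adj G x u  ≡⟨ isModule⇒adjˡ≡ M′-mod x∈M′ w∈M′ (x∈∁p⇒x∉p u∈∁M′) ⟩
      adj G w u  ≡⟨ isModule⇒adjʳ≡ M-mod w∉M u∈M v∈M ⟩
      adj G w v  ≡⟨ isModule⇒adjˡ≡ M′-mod w∈M′ x∈M′ (x∈∁p⇒x∉p v∈∁M′) ⟩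
      adj G x v  ∎
      where open ≡.≡-Reasoning
    ... | no  x∉M′ =
      isModule⇒adjʳ≡ M-mod (λ x∈M → x∉D (x∈p∩q⁺ (x∈M , x∉p⇒x∈∁p x∉M′))) u∈M v∈M

  isModuleIn⇒isModule : IsModule G M → X ⊆ M → IsModuleIn G M X → IsModule G X
  isModuleIn⇒isModule {M = M} M-mod X⊆M X-modIn x x∉X with x ∈? M
  ... | yes x∈M = X-modIn x x∈M x∉X
  ... | no  x∉M = allOrNone-⊆ X⊆M (M-mod x x∉M)

  uniform⇒isModuleIn : Uniform k S → X ⊆ S → IsModuleIn G S X
  uniform⇒isModuleIn {k = k} S-uni X⊆S x x∈S x∉X =
    constant⇒allOrNone k (λ y y∈X → S-uni x y x∈S (X⊆S y∈X) (λ { refl → x∉X y∈X }))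

  stable⇒uniform : IsStable G S → Uniform false S
  stable⇒uniform S-stable x y x∈S y∈S _ = S-stable x y x∈S y∈S

  uniform⇒stable : Uniform false S → IsStable G S
  uniform⇒stable S-uni x y x∈S y∈S with x ≟ y
  ... | yes refl = irrefl G x
  ... | no  x≢y  = S-uni x y x∈S y∈S x≢y

  uniform-unique : 2 ≤ ∣ S ∣ → Uniform k S → Uniform k′ S → k ≡ k′
  uniform-unique {S = S} 2≤∣S∣ S-uni S-uni′
    with x , x∈S ← 0<∣p∣⇒nonempty (≤-trans (s≤s z≤n) 2≤∣S∣)
    with y , y∈S , y≢x ← 1<∣p∣⇒∃≢ 2≤∣S∣ x
    = trans (≡.sym (S-uni y x y∈S x∈S y≢x)) (S-uni′ y x y∈S x∈S y≢x)

  prime⇒¬uniform : IsPrimeInduced G S → ¬ Uniform k S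
  prime⇒¬uniform {S = S} (4≤∣S∣ , trivial) S-uni
    with x , x∈S ← 0<∣p∣⇒nonempty (≤-trans (s≤s z≤n) 4≤∣S∣)
    with y , y∈S , y≢x ← 1<∣p∣⇒∃≢ (≤-trans (s≤s (s≤s z≤n)) 4≤∣S∣) x
    = nontrivial (trivial (pair x y) xy⊆S (uniform⇒isModuleIn S-uni xy⊆S))
    where
    xy⊆S : pair x y ⊆ S
    xy⊆S = pair⊆p x∈S y∈S
    ∣xy∣≡2 : ∣ pair x y ∣ ≡ 2
    ∣xy∣≡2 = ≤-antisym (∣pair∣≤2 x y) (2≤∣pair∣ (≢-sym y≢x))
    nontrivial : ¬ (pair x y ≡ ⊥ ⊎ pair x y ≡ S ⊎ ∃ λ v → pair x y ≡ ⁅ v ⁆)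
    nontrivial (inj₁ xy≡⊥) =
      contradiction (trans (≡.sym ∣xy∣≡2) (trans (cong ∣_∣ xy≡⊥) (∣⊥∣≡0 n))) λ ()
    nontrivial (inj₂ (inj₁ xy≡S)) =
      contradiction (subst (4 ≤_) (trans (cong ∣_∣ (≡.sym xy≡S)) ∣xy∣≡2) 4≤∣S∣) λ { (s≤s (s≤s ())) }
    nontrivial (inj₂ (inj₂ (v , xy≡⁅v⁆))) =
      contradiction (trans (≡.sym ∣xy∣≡2) (trans (cong ∣_∣ xy≡⁅v⁆) (∣⁅x⁆∣≡1 v))) λ ()

  pair-Mmin : x ≢ y → IsModule G (pair x y) → InMmin G (pair x y)
  pair-Mmin {x = x} {y = y} x≢y xy-mod =
    xy-mod , 2≤∣pair∣ x≢y ,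
    λ M _ 2≤∣M∣ M⊆xy → p⊆q∧∣q∣≤∣p∣⇒p≡q M⊆xy (≤-trans (∣pair∣≤2 x y) 2≤∣M∣)

  Mmin-⊂⇒∣∣≤1 : InMmin G M → IsModule G X → X ⊂ M → ∣ X ∣ ≤ 1
  Mmin-⊂⇒∣∣≤1 {X = X} (_ , _ , minimal) X-mod X⊂M with 2 ≤? ∣ X ∣
  ... | yes 2≤∣X∣ = contradiction (minimal X X-mod 2≤∣X∣ (p⊂q⇒p⊆q X⊂M)) (λ X≡M → ⊂-irref X≡M X⊂M)
  ... | no  2≰∣X∣ = s≤s⁻¹ (≰⇒> 2≰∣X∣)

  Mmin-overlap : InMmin G M → 3 ≤ ∣ M ∣ → InMmin G M′ → u ∈ M → u ∈ M′ → M′ ≡ M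
  Mmin-overlap {M = M} {M′ = M′} {u = u}
    M-min@(M-mod , 2≤∣M∣ , M-minimal) 3≤∣M∣ (M′-mod , 2≤∣M′∣ , M′-minimal) u∈M u∈M′
    with ⊆⊎∃∉ M′ M | ⊆⊎∃∉ M M′
  ... | inj₁ M′⊆M | _ = M-minimal M′ M′-mod 2≤∣M′∣ M′⊆M
  ... | inj₂ _ | inj₁ M⊆M′ = ≡.sym (M′-minimal M M-mod 2≤∣M∣ M⊆M′)
  ... | inj₂ (w , w∈M′ , w∉M) | inj₂ (y , y∈M , y∉M′) = contradiction 3≤∣M∣ (≤⇒≯ ∣M∣≤2)
    where
    ∣M∩M′∣≤1 : ∣ M ∩ M′ ∣ ≤ 1
    ∣M∩M′∣≤1 = Mmin-⊂⇒∣∣≤1 M-min (∩-isModule M-mod M′-mod)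
                 (p∩q⊆p M M′ , y , y∈M , y∉M′ ∘ proj₂ ∘ x∈p∩q⁻ M M′)
    ∣M∖M′∣≤1 : ∣ M ∩ ∁ M′ ∣ ≤ 1
    ∣M∖M′∣≤1 = Mmin-⊂⇒∣∣≤1 M-min (∖-isModule M-mod M′-mod w∈M′ w∉M)
                 (p∩q⊆p M (∁ M′) , u , u∈M ,
                  λ u∈M∖M′ → x∈∁p⇒x∉p (proj₂ (x∈p∩q⁻ M (∁ M′) u∈M∖M′)) u∈M′)
    M⊆∩∪∖ : M ⊆ (M ∩ M′) ∪ (M ∩ ∁ M′)
    M⊆∩∪∖ {x} x∈M with x ∈? M′
    ... | yes x∈M′ = x∈p∪q⁺ (inj₁ (x∈p∩q⁺ (x∈M , x∈M′)))
    ... | no  x∉M′ = x∈p∪q⁺ (inj₂ (x∈p∩q⁺ (x∈M , x∉p⇒x∈∁p x∉M′)))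
    ∣M∣≤2 : ∣ M ∣ ≤ 2
    ∣M∣≤2 = ≤-trans (p⊆q⇒∣p∣≤∣q∣ M⊆∩∪∖)
              (≤-trans (∣p∪q∣≤∣p∣+∣q∣ (M ∩ M′) (M ∩ ∁ M′)) (+-mono-≤ ∣M∩M′∣≤1 ∣M∖M′∣≤1))

  adj≡⇒allOrNone-pair : adj G z x ≡ adj G z y → AllOrNone z (pair x y)
  adj≡⇒allOrNone-pair {z = z} {x = x} {y = y} zx≡zy = constant⇒allOrNone (adj G z x) same
    where
    same : ∀ u → u ∈ pair x y → adj G z u ≡ adj G z x
    same u u∈xy with ∈pair⁻ u∈xy
    ... | inj₁ refl = refl
    ... | inj₂ refl = ≡.sym zx≡zy

  -- As M is minimal and z ∉ {x, y}, some d ∈ M splits {x, y}; z does not, so d is a fourth vertex.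
  Mmin-adj≡⇒4≤∣∣ : InMmin G M → x ∈ M → y ∈ M → z ∈ M → x ≢ y → z ≢ x → z ≢ y →
                   adj G z x ≡ adj G z y → 4 ≤ ∣ M ∣
  Mmin-adj≡⇒4≤∣∣ {M = M} {x = x} {y = y} {z = z}
    (M-mod , _ , M-minimal) x∈M y∈M z∈M x≢y z≢x z≢y zx≡zy
    with any? (λ d → d ∈? M ×-dec ¬? (d ∈? pair x y) ×-dec ¬? (adj G d x Bool.≟ adj G d y))
  ... | yes (d , d∈M , d∉xy , dx≢dy) =
    let d≢x , d≢y = ∉pair⇒≢ d∉xy in
    unique⇒length≤∣p∣
      ((x≢y ∷ ≢-sym z≢x ∷ ≢-sym d≢x ∷ []) ∷ (≢-sym z≢y ∷ ≢-sym d≢y ∷ []) ∷ (z≢d ∷ []) ∷ [] ∷ [])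
      (x∈M ∷ y∈M ∷ z∈M ∷ d∈M ∷ [])
    where
    z≢d : z ≢ d
    z≢d refl = dx≢dy zx≡zy
  ... | no no-splitter =
    contradiction (M-minimal (pair x y) xy-mod (2≤∣pair∣ x≢y) xy⊆M)
                  (λ xy≡M → ≢⇒∉pair z≢x z≢y (subst (z ∈_) (≡.sym xy≡M) z∈M))
    where
    xy⊆M : pair x y ⊆ M
    xy⊆M = pair⊆p x∈M y∈M
    xy-mod : IsModule G (pair x y)
    xy-mod = isModuleIn⇒isModule M-mod xy⊆M λ d d∈M d∉xy →
      adj≡⇒allOrNone-pair (decidable-stable (adj G d x Bool.≟ adj G d y)
                                            (λ dx≢dy → no-splitter (d , d∈M , d∉xy , dx≢dy)))

  Mmin-4≤∣∣ : InMmin G M → 3 ≤ ∣ M ∣ → 4 ≤ ∣ M ∣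
  Mmin-4≤∣∣ {M = M} M-min 3≤∣M∣
    with a , a∈M ← 0<∣p∣⇒nonempty (≤-trans (s≤s z≤n) 3≤∣M∣)
    with b , b∈M , b≢a ← 1<∣p∣⇒∃≢ (≤-trans (s≤s (s≤s z≤n)) 3≤∣M∣) a
    with c , c∈M , c∉ab ← ∣q∣<∣p∣⇒∃∈p∖q (≤-trans (s≤s (∣pair∣≤2 a b)) 3≤∣M∣)
    with c≢a , c≢b ← ∉pair⇒≢ c∉ab
    -- two of the three values agree, and the common endpoint of those two edges sees the others alike
    with bool-pigeonhole (adj G a b) (adj G b c) (adj G c a)
  ... | inj₁ ab≡bc =
    Mmin-adj≡⇒4≤∣∣ M-min a∈M c∈M b∈M (≢-sym c≢a) b≢a (≢-sym c≢b) (trans (sym G b a) ab≡bc)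
  ... | inj₂ (inj₁ bc≡ca) =
    Mmin-adj≡⇒4≤∣∣ M-min b∈M a∈M c∈M b≢a c≢b c≢a (trans (sym G c b) bc≡ca)
  ... | inj₂ (inj₂ ca≡ab) =
    Mmin-adj≡⇒4≤∣∣ M-min c∈M b∈M a∈M c≢b (≢-sym c≢a) (≢-sym b≢a) (trans (sym G a c) ca≡ab)

  Mmin-prime : InMmin G M → 3 ≤ ∣ M ∣ → IsPrimeInduced G M
  Mmin-prime {M = M} M-min@(M-mod , _ , M-minimal) 3≤∣M∣ = Mmin-4≤∣∣ M-min 3≤∣M∣ , trivial
    where
    trivial : ∀ X → X ⊆ M → IsModuleIn G M X → X ≡ ⊥ ⊎ X ≡ M ⊎ ∃ λ v → X ≡ ⁅ v ⁆
    trivial X X⊆M X-modIn with 2 ≤? ∣ X ∣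
    ... | yes 2≤∣X∣ = inj₂ (inj₁ (M-minimal X (isModuleIn⇒isModule M-mod X⊆M X-modIn) 2≤∣X∣ X⊆M))
    ... | no  2≰∣X∣ = Sum.map₂ inj₂ (∣p∣≤1⇒p≡⊥⊎⁅x⁆ (s≤s⁻¹ (≰⇒> 2≰∣X∣)))

  pairModulesAt⇒adj≡ : PairModulesAt u S → w ∈ S → x ≢ u → x ≢ w → adj G x u ≡ adj G x w
  pairModulesAt⇒adj≡ {u = u} {w = w} uS-pairs w∈S x≢u x≢w with w ≟ u
  ... | yes refl = refl
  ... | no  w≢u  = pair-isModule⇒adj≡ (uS-pairs w w∈S w≢u) x≢u x≢w

  pairModulesAt⇒isModule : u ∈ S → PairModulesAt u S → IsModule G S
  pairModulesAt⇒isModule {u = u} {S = S} u∈S uS-pairs = adj≡⇒isModule alike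
    where
    alike : x ∉ S → v ∈ S → w ∈ S → adj G x v ≡ adj G x w
    alike x∉S v∈S w∈S =
      trans (≡.sym (pairModulesAt⇒adj≡ uS-pairs v∈S (x≢ u∈S) (x≢ v∈S)))
            (pairModulesAt⇒adj≡ uS-pairs w∈S (x≢ u∈S) (x≢ w∈S))
      where
      x≢ : y ∈ S → _ ≢ y
      x≢ y∈S refl = x∉S y∈S

  pairModulesAt⇒adjᵘ≡ : PairModulesAt u S → v ∈ S → v ≢ u → w ∈ S → w ≢ u → adj G u w ≡ adj G u v
  pairModulesAt⇒adjᵘ≡ {u = u} {v = v} {w = w} uS-pairs v∈S v≢u w∈S w≢u with w ≟ v
  ... | yes refl = refl
  ... | no  w≢v  = begin
    adj G u w  ≡⟨ sym G u w ⟩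
    adj G w u  ≡⟨ pairModulesAt⇒adj≡ uS-pairs v∈S w≢u w≢v ⟩
    adj G w v  ≡⟨ sym G w v ⟩
    adj G v w  ≡⟨ pairModulesAt⇒adj≡ uS-pairs w∈S v≢u (≢-sym w≢v) ⟨
    adj G v u  ≡⟨ sym G v u ⟩
    adj G u v  ∎
    where open ≡.≡-Reasoning

  pairModulesAt⇒uniform : PairModulesAt u S → v ∈ S → v ≢ u → Uniform (adj G u v) S
  pairModulesAt⇒uniform {u = u} {v = v} uS-pairs v∈S v≢u x y x∈S y∈S x≢y with x ≟ u
  ... | yes refl = pairModulesAt⇒adjᵘ≡ uS-pairs v∈S v≢u y∈S (≢-sym x≢y)
  ... | no  x≢u  = begin
    adj G x y  ≡⟨ pairModulesAt⇒adj≡ uS-pairs y∈S x≢u x≢y ⟨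
    adj G x u  ≡⟨ sym G x u ⟩
    adj G u x  ≡⟨ pairModulesAt⇒adjᵘ≡ uS-pairs v∈S v≢u x∈S x≢u ⟩
    adj G u v  ∎
    where open ≡.≡-Reasoning

  module _ {C : Subset n} {u : Fin n} (C≈u : ∀ v → v ∈ C ⇔ _≈G_ G u v) where

    private
      ∈C⇒≈ : v ∈ C → _≈G_ G u v
      ∈C⇒≈ = Equivalence.to (C≈u _)

      ≈⇒∈C : _≈G_ G u v → v ∈ C
      ≈⇒∈C = Equivalence.from (C≈u _)

      u∈C : u ∈ C
      u∈C = ≈⇒∈C (inj₁ refl)

    class≡Mmin : InMmin G M → 3 ≤ ∣ M ∣ → u ∈ M → C ≡ M
    class≡Mmin {M = M} M-min 3≤∣M∣ u∈M = ⊆-antisym C⊆M (λ w∈M → ≈⇒∈C (inj₂ (M , M-min , u∈M , w∈M)))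
      where
      C⊆M : C ⊆ M
      C⊆M {w} w∈C with ∈C⇒≈ w∈C
      ... | inj₁ refl = u∈M
      ... | inj₂ (M′ , M′-min , u∈M′ , w∈M′) =
        subst (w ∈_) (Mmin-overlap M-min 3≤∣M∣ M′-min u∈M u∈M′) w∈M′

    class-pairModules : (∀ {M} → InMmin G M → u ∈ M → ∣ M ∣ ≤ 2) → PairModulesAt u C
    class-pairModules small w w∈C w≢u with ∈C⇒≈ w∈C
    ... | inj₁ u≡w = contradiction (≡.sym u≡w) w≢u
    ... | inj₂ (M , M-min@(M-mod , _) , u∈M , w∈M) =
      subst (IsModule G) (≡.sym M≡uw) M-mod
      where
      M≡uw : pair u w ≡ M
      M≡uw = p⊆q∧∣q∣≤∣p∣⇒p≡q (pair⊆p u∈M w∈M) (≤-trans (small M-min u∈M) (2≤∣pair∣ (≢-sym w≢u)))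

    class-maximal : IsModule G M → Uniform k M → C ⊆ M → M ≡ C
    class-maximal {M = M} M-mod M-uni C⊆M = ⊆-antisym M⊆C C⊆M
      where
      M⊆C : M ⊆ C
      M⊆C {w} w∈M with w ≟ u
      ... | yes refl = u∈C
      ... | no  w≢u  = ≈⇒∈C (inj₂ (pair u w , pair-Mmin (≢-sym w≢u) uw-mod , x∈pair , y∈pair))
        where
        uw⊆M : pair u w ⊆ M
        uw⊆M = pair⊆p (C⊆M u∈C) w∈M
        uw-mod : IsModule G (pair u w)
        uw-mod = isModuleIn⇒isModule M-mod uw⊆M (uniform⇒isModuleIn M-uni uw⊆M)

    uniform-class⇒maximal : IsModule G C → Uniform k C → MaxCliqueModule G C ⊎ MaxStableModule G C
    uniform-class⇒maximal {k = true}  C-mod C-uni =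
      inj₁ (C-mod , C-uni , λ M M-mod M-clique → class-maximal M-mod M-clique)
    uniform-class⇒maximal {k = false} C-mod C-uni =
      inj₂ (C-mod , uniform⇒stable C-uni ,
            λ M M-mod M-stable → class-maximal M-mod (stable⇒uniform M-stable))

    class-trichotomy : 2 ≤ ∣ C ∣ → InP G C ⊎ MaxCliqueModule G C ⊎ MaxStableModule G C
    class-trichotomy 2≤∣C∣ with v , v∈C , v≢u ← 1<∣p∣⇒∃≢ 2≤∣C∣ u with ∈C⇒≈ v∈C
    ... | inj₁ u≡v = contradiction (≡.sym u≡v) v≢u
    ... | inj₂ (M , M-min , u∈M , _) with 3 ≤? ∣ M ∣
    ... | yes 3≤∣M∣ =
      inj₁ (subst (InP G) (≡.sym (class≡Mmin M-min 3≤∣M∣ u∈M)) (proj₁ M-min , Mmin-prime M-min 3≤∣M∣))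
    ... | no  3≰∣M∣ =
      inj₂ (uniform-class⇒maximal (pairModulesAt⇒isModule u∈C pairs)
                                  (pairModulesAt⇒uniform pairs v∈C v≢u))
      where
      -- A minimal module through u with three vertices would be M itself.
      pairs : PairModulesAt u C
      pairs = class-pairModules λ M′-min u∈M′ → s≤s⁻¹ (≰⇒> λ 3≤∣M′∣ →
        3≰∣M∣ (subst (λ X → 3 ≤ ∣ X ∣) (≡.sym (Mmin-overlap M′-min 3≤∣M′∣ M-min u∈M′ u∈M)) 3≤∣M′∣))

lemma12 : (n : ℕ) (G : Graph n) (C : Subset n) → IsClass G C → 2 ≤ ∣ C ∣ →
    ExactlyOne (InP G C) (MaxCliqueModule G C) (MaxStableModule G C)
lemma12 n G C (u , C≈u) 2≤∣C∣ =
    class-trichotomy G C≈u 2≤∣C∣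
  , (λ ((_ , prime) , (_ , clique , _)) → prime⇒¬uniform G prime clique)
  , (λ ((_ , prime) , (_ , stable , _)) → prime⇒¬uniform G prime (stable⇒uniform G stable))
  , (λ ((_ , clique , _) , (_ , stable , _)) →
       contradiction (uniform-unique G 2≤∣C∣ clique (stable⇒uniform G stable)) λ ())
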